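{- Let $q$ be an odd prime power. For every integer $r$ with $0\le r\le (q-5)/2$ there exists a set without tangents in $\mathrm{PG}(2,q)$ of size $q(q-1)/2-r(q+1)/2$.
   Context: A set of points $\mathcal{S}$ in $\mathrm{PG}(2,q)$ is a set without tangents if no line meets $\mathcal{S}$ in exactly one point. -}

module Defs where

open import Level using (0ℓ)
open import Data.Nat using (ℕ; _+_; _*_; _^_; _≤_) renaming (_≡ᵇ_ to _≡ᵇ_)
open import Data.Nat.Primality using (Prime)
open import Data.Nat.Divisibility using (_∣_)
open import Data.Fin using (Fin)
open import Data.Product using (Σ; ∃; ∃-syntax; _×_; _,_)
open import Data.Sum using (_⊎_)
open import Data.List using (List)
open import Data.List.Membership.Propositional using (_∈_)
open import Relation.Nullary using (¬_)
open import Relation.Binary.PropositionalEquality using (_≡_)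
open import Algebra.Structures using (IsCommutativeRing)

IsPrimePower : ℕ → Set
IsPrimePower q = ∃[ p ] ∃[ k ] (Prime p × 1 ≤ k × q ≡ p ^ k)

-- A finite field of order q, realised on the carrier Fin q
-- (every field of order q is isomorphic to GF(q)).
record FiniteField (q : ℕ) : Set where
  field
    _+F_ _*F_ : Fin q → Fin q → Fin q
    -F_       : Fin q → Fin q
    0F 1F     : Fin q
    isCommutativeRing : IsCommutativeRing _≡_ _+F_ _*F_ -F_ 0F 1F
    0≢1      : ¬ (0F ≡ 1F)
    inverse  : ∀ x → ¬ (x ≡ 0F) → ∃[ y ] (x *F y ≡ 1F)

module PG2 {q : ℕ} (F : FiniteField q) where
  open FiniteField F

  Vec3 : Set
  Vec3 = Fin q × Fin q × Fin q

  -- canonical representative of a projective point (or line):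
  -- the first nonzero coordinate equals 1
  Normalized : Vec3 → Set
  Normalized (x , y , z) =
    (x ≡ 1F) ⊎ ((x ≡ 0F × y ≡ 1F) ⊎ (x ≡ 0F × y ≡ 0F × z ≡ 1F))

  Incident : Vec3 → Vec3 → Set
  Incident (a , b , c) (x , y , z) = ((a *F x) +F (b *F y)) +F (c *F z) ≡ 0F

  WithoutTangents : List Vec3 → Set
  WithoutTangents S =
    ∀ L → Normalized L →
      ¬ (∃[ P ] (P ∈ S × Incident L P × (∀ P′ → P′ ∈ S → Incident L P′ → P′ ≡ P)))

-- Fill the affine points (1, y, z) column by column (y fixed, z varying) with n
-- points, so that at least two columns are full and the last, partial column
-- does not hold exactly one point.  A line [a, b, 0] meets the set in the part
-- of one column, never a single point; any other line meets each full column.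
-- For q = 2t + 1 the required size n = qt − r(t + 1) satisfies 2q ≤ n ≤ q² and
-- 2n ≡ −r (mod q), so n ≢ 1 (mod q) since 0 < r + 2 < q.  Only the field
-- structure of GF(q) is used, not that q is a prime power.

module Submission where

open import Defs
open import Data.Nat using (ℕ; _+_; _*_; _∸_; _/_; _≤_; _%_)
open import Data.Product using (∃-syntax; _×_)
open import Data.List using (List; length)
open import Data.List.Relation.Unary.All using (All)
open import Data.List.Relation.Unary.Unique.Propositional using (Unique)
open import Relation.Binary.PropositionalEquality using (_≡_)

open import Data.Nat using (zero; suc; _⊓_; _<_; s≤s; z≤n; s≤s⁻¹)
open import Data.Nat.Properties
  using (≤-refl; ≤-trans; ≤-reflexive; n≤0⇒n≡0; *-zeroʳ; *-suc; ⊓-comm; ⊓-glb; m⊓n+n∸m≡n;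
         m≤n+o⇒m∸n≤o; m+n≤o⇒m≤o∸n; +-comm; m≤m*n; ∸-+-assoc;
         m+[n∸m]≡n; *-cancelʳ-≤; m+n∸m≡n; m∸n≤m; *-monoʳ-≤; m∸n+n≡m; <⇒≤; <⇒≱;
         m∸n≢0⇒n<m; m≤m+n; 1+n≢0)
import Data.Nat.Properties as ℕ
open import Data.Nat.Divisibility using (_∣_; divides; ∣m+n∣m⇒∣n; ∣⇒≤; m∣m*n)
open import Data.Nat.DivMod using (m≡m%n+[m/n]*n; m*n/n≡m; m/n≤m)
open import Data.Nat.Tactic.RingSolver using (solve)
open import Data.Fin using (Fin; zero; suc) renaming (_≟_ to _≟ᶠ_)
open import Data.List using ([]; _∷_; _++_; map; take; allFin)
open import Data.List.Properties using (length-map; length-take; length-tabulate; length-++; take-all)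
open import Data.List.Membership.Propositional using (_∈_)
open import Data.List.Membership.Propositional.Properties
  using (∈-++⁺ˡ; ∈-++⁺ʳ; ∈-++⁻; ∈-map⁺; ∈-map⁻; ∈-allFin)
open import Data.List.Relation.Unary.All using (lookup; head; tabulate)
import Data.List.Relation.Unary.AllPairs as AllPairs
open import Data.List.Relation.Unary.Any using (here; there)
open import Data.List.Relation.Unary.Unique.Propositional.Properties
  using (map⁺; take⁺; allFin⁺; ++⁺)
open import Data.Product using (_,_)
open import Data.Sum using (inj₁; inj₂)
open import Data.Empty using (⊥-elim)
open import Relation.Nullary using (¬_; yes; no)
open import Relation.Binary.Definitions using (DecidableEquality)
open import Relation.Binary.PropositionalEquality
  using (_≢_; refl; sym; trans; cong; cong₂; subst; subst₂; module ≡-Reasoning)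
open import Algebra.Structures using (IsCommutativeRing)

other-∈ : ∀ {a} {A : Set a} → DecidableEquality A → ∀ {xs : List A} →
          Unique xs → 2 ≤ length xs → (x : A) → ∃[ y ] (y ∈ xs × y ≢ x)
other-∈ _≟_ {u ∷ v ∷ _} (u∉rest AllPairs.∷ _) (s≤s (s≤s _)) x with x ≟ u
... | yes refl = v , there (here refl) , λ v≡u → head u∉rest (sym v≡u)
... | no x≢u   = u , here refl , λ u≡x → x≢u (sym u≡x)

FiniteField-order≥2 : ∀ {q} → FiniteField q → 2 ≤ q
FiniteField-order≥2 {zero} F with FiniteField.0F F
... | ()
FiniteField-order≥2 {suc zero} F with FiniteField.0F F | FiniteField.1F F | FiniteField.0≢1 F
... | zero | zero | 0≢1 = ⊥-elim (0≢1 refl)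
FiniteField-order≥2 {suc (suc _)} F = s≤s (s≤s z≤n)

-- n mod q ≢ 1, phrased without division.
Remainder≢1 : ℕ → ℕ → Set
Remainder≢1 q n = ∀ j → n ∸ j * q ≢ 1

module AffineColumns {q : ℕ} (F : FiniteField q) where
  open FiniteField F
  open IsCommutativeRing isCommutativeRing using (zeroˡ; *-comm; *-assoc; *-identityˡ; -‿inverseʳ)
  open PG2 F

  affine : Fin q → Fin q → Vec3
  affine y z = 1F , y , z

  affine-injectiveˡ : ∀ {y z y′ z′} → affine y z ≡ affine y′ z′ → y ≡ y′
  affine-injectiveˡ refl = refl

  affine-injectiveʳ : ∀ {y z y′ z′} → affine y z ≡ affine y′ z′ → z ≡ z′
  affine-injectiveʳ refl = refl

  length-take-allFin : ∀ n → length (take n (allFin q)) ≡ n ⊓ q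
  length-take-allFin n = trans (length-take n (allFin q)) (cong (n ⊓_) (length-tabulate (λ i → i)))

  2≤length-take-allFin : ∀ {n} → 2 ≤ n → 2 ≤ length (take n (allFin q))
  2≤length-take-allFin {n} 2≤n =
    subst (2 ≤_) (sym (length-take-allFin n)) (⊓-glb 2≤n (FiniteField-order≥2 F))

  column : ℕ → Fin q → List Vec3
  column n y = map (affine y) (take n (allFin q))

  -- Fills the columns ys in turn, q points each, until n points are used;
  -- as n ∸ q truncates, every column after the partial one is empty.
  columns : ℕ → List (Fin q) → List Vec3
  columns n []       = []
  columns n (y ∷ ys) = column n y ++ columns (n ∸ q) ys

  length-columns : ∀ n ys → n ≤ q * length ys → length (columns n ys) ≡ n
  length-columns n [] n≤0 = sym (n≤0⇒n≡0 (≤-trans n≤0 (≤-reflexive (*-zeroʳ q))))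
  length-columns n (y ∷ ys) n≤q+q*l = begin
    length (column n y ++ columns (n ∸ q) ys)          ≡⟨ length-++ (column n y) ⟩
    length (column n y) + length (columns (n ∸ q) ys)  ≡⟨ cong₂ _+_ length-column
                                                          (length-columns (n ∸ q) ys n∸q≤q*l) ⟩
    n ⊓ q + (n ∸ q)                                    ≡⟨ cong (_+ (n ∸ q)) (⊓-comm n q) ⟩
    q ⊓ n + (n ∸ q)                                    ≡⟨ m⊓n+n∸m≡n q n ⟩
    n                                                  ∎
    where
    open ≡-Reasoning
    length-column : length (column n y) ≡ n ⊓ q
    length-column = trans (length-map (affine y) (take n (allFin q))) (length-take-allFin n)
    n∸q≤q*l : n ∸ q ≤ q * length ys
    n∸q≤q*l = m≤n+o⇒m∸n≤o n q (≤-trans n≤q+q*l (≤-reflexive (*-suc q (length ys))))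

  ∈-columns⁻ : ∀ n ys {P} → P ∈ columns n ys → ∃[ y ] ∃[ z ] (y ∈ ys × P ≡ affine y z)
  ∈-columns⁻ n (y ∷ ys) P∈ with ∈-++⁻ (column n y) P∈
  ... | inj₁ P∈column with ∈-map⁻ (affine y) P∈column
  ...   | z , _ , P≡ = y , z , here refl , P≡
  ∈-columns⁻ n (y ∷ ys) P∈ | inj₂ P∈rest with ∈-columns⁻ (n ∸ q) ys P∈rest
  ...   | y′ , z , y′∈ , P≡ = y′ , z , there y′∈ , P≡

  columns-unique : ∀ n {ys} → Unique ys → Unique (columns n ys)
  columns-unique n {[]}     _                      = AllPairs.[]
  columns-unique n {y ∷ ys} (y∉ys AllPairs.∷ ys!) =
    ++⁺ (map⁺ affine-injectiveʳ (take⁺ n (allFin⁺ q))) (columns-unique (n ∸ q) ys!) disjoint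
    where
    disjoint : ∀ {P} → ¬ (P ∈ column n y × P ∈ columns (n ∸ q) ys)
    disjoint (P∈column , P∈rest) with ∈-map⁻ (affine y) P∈column | ∈-columns⁻ (n ∸ q) ys P∈rest
    ... | _ , _ , refl | _ , _ , y′∈ys , P≡ =
      lookup y∉ys y′∈ys (affine-injectiveˡ P≡)

  ∈-columns-full : ∀ m n ys {y} z → y ∈ take m ys → q * m ≤ n → affine y z ∈ columns n ys
  ∈-columns-full (suc m) n (y ∷ ys) z (here refl) qm≤n =
    ∈-++⁺ˡ (∈-map⁺ (affine y) (subst (z ∈_) (sym all-taken) (∈-allFin z)))
    where
    all-taken : take n (allFin q) ≡ allFin q
    all-taken = take-all n (allFin q)
      (subst (_≤ n) (sym (length-tabulate (λ i → i))) (≤-trans (m≤m*n q (suc m)) qm≤n))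
  ∈-columns-full (suc m) n (y′ ∷ ys) z (there y∈) qm≤n =
    ∈-++⁺ʳ (column n y′) (∈-columns-full m (n ∸ q) ys z y∈
      (m+n≤o⇒m≤o∸n (q * m) (subst (_≤ n) (trans (*-suc q m) (+-comm q (q * m))) qm≤n)))

  other-in-column : ∀ {n y z y′} → n ≢ 1 → affine y z ∈ column n y′ →
                    ∃[ z′ ] (z′ ≢ z × affine y z′ ∈ column n y′)
  other-in-column {n} {y} {z} {y′} n≢1 P∈ with ∈-map⁻ (affine y′) P∈
  ... | _ , z∈ , refl
      with other-∈ _≟ᶠ_ (take⁺ n (allFin⁺ q)) (2≤length-take-allFin (2≤n n≢1 z∈)) z
    where
    2≤n : ∀ {n} → n ≢ 1 → z ∈ take n (allFin q) → 2 ≤ n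
    2≤n {suc zero}    n≢1 _ = ⊥-elim (n≢1 refl)
    2≤n {suc (suc _)} _   _ = s≤s (s≤s z≤n)
  ...   | z′ , z′∈ , z′≢z = z′ , z′≢z , ∈-map⁺ (affine y) z′∈

  other-in-columns : ∀ n ys {y z} → Remainder≢1 q n → affine y z ∈ columns n ys →
                     ∃[ z′ ] (z′ ≢ z × affine y z′ ∈ columns n ys)
  other-in-columns n (y′ ∷ ys) rem P∈ with ∈-++⁻ (column n y′) P∈
  ... | inj₁ P∈column with other-in-column (rem 0) P∈column
  ...   | z′ , z′≢z , z′∈ = z′ , z′≢z , ∈-++⁺ˡ z′∈
  other-in-columns n (y′ ∷ ys) rem P∈ | inj₂ P∈rest with other-in-columns (n ∸ q) ys rem′ P∈rest
    where
    rem′ : Remainder≢1 q (n ∸ q)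
    rem′ j = subst (_≢ 1) (sym (∸-+-assoc n q (j * q))) (rem (suc j))
  ...   | z′ , z′≢z , z′∈ = z′ , z′≢z , ∈-++⁺ʳ (column n y′) z′∈

  incident-vertical : ∀ {a b c y z} z′ → c ≡ 0F →
                      Incident (a , b , c) (affine y z) → Incident (a , b , c) (affine y z′)
  incident-vertical {a} {b} {c} {y} {z} z′ c≡0 on = trans (c-term z′) (trans (sym (c-term z)) on)
    where
    u = (a *F 1F) +F (b *F y)
    c-term : ∀ w → u +F (c *F w) ≡ u +F 0F
    c-term w = cong (u +F_) (trans (cong (_*F w) c≡0) (zeroˡ w))

  incident-solved : ∀ {a b c c⁻¹} y → c *F c⁻¹ ≡ 1F →
                    Incident (a , b , c) (affine y ((-F ((a *F 1F) +F (b *F y))) *F c⁻¹))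
  incident-solved {a} {b} {c} {c⁻¹} y cc⁻¹≡1 = begin
    u +F (c *F (-u *F c⁻¹))  ≡⟨ cong (λ w → u +F (c *F w)) (*-comm -u c⁻¹) ⟩
    u +F (c *F (c⁻¹ *F -u))  ≡⟨ cong (u +F_) (sym (*-assoc c c⁻¹ -u)) ⟩
    u +F ((c *F c⁻¹) *F -u)  ≡⟨ cong (λ w → u +F (w *F -u)) cc⁻¹≡1 ⟩
    u +F (1F *F -u)          ≡⟨ cong (u +F_) (*-identityˡ -u) ⟩
    u +F -u                  ≡⟨ -‿inverseʳ u ⟩
    0F                       ∎
    where
    open ≡-Reasoning
    u = (a *F 1F) +F (b *F y)
    -u = -F u

  columns-withoutTangents : ∀ {n} → q * 2 ≤ n → Remainder≢1 q n →
                            WithoutTangents (columns n (allFin q))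
  columns-withoutTangents {n} 2q≤n rem (a , b , c) _ (P , P∈ , P-on , only-P)
    with ∈-columns⁻ n (allFin q) P∈
  ... | y , z , _ , refl with c ≟ᶠ 0F
  ...   | yes c≡0 with other-in-columns n (allFin q) rem P∈
  ...     | z′ , z′≢z , z′∈ =
            z′≢z (affine-injectiveʳ (only-P _ z′∈ (incident-vertical z′ c≡0 P-on)))
  columns-withoutTangents {n} 2q≤n rem (a , b , c) _ (P , P∈ , P-on , only-P)
      | y , z , _ , refl | no c≢0 with inverse c c≢0
  ...     | c⁻¹ , cc⁻¹≡1
          with other-∈ _≟ᶠ_ (take⁺ 2 (allFin⁺ q)) (2≤length-take-allFin ≤-refl) y
  ...       | y′ , y′∈ , y′≢y =
              y′≢y (affine-injectiveˡ (only-P _ (∈-columns-full 2 n (allFin q) _ y′∈ 2q≤n)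
                                                (incident-solved y′ cc⁻¹≡1)))

  tangentFree-of-size : ∀ {n} → q * 2 ≤ n → n ≤ q * q → Remainder≢1 q n →
    ∃[ S ] (All Normalized S × Unique S × WithoutTangents S × length S ≡ n)
  tangentFree-of-size {n} 2q≤n n≤q² rem =
      columns n (allFin q)
    , tabulate normalized
    , columns-unique n (allFin⁺ q)
    , columns-withoutTangents 2q≤n rem
    , length-columns n (allFin q)
        (subst (λ l → n ≤ q * l) (sym (length-tabulate (λ i → i))) n≤q²)
    where
    normalized : ∀ {P} → P ∈ columns n (allFin q) → Normalized P
    normalized P∈ with ∈-columns⁻ n (allFin q) P∈
    ... | _ , _ , _ , refl = inj₁ refl

odd-decomposition : ∀ {q} r → q % 2 ≡ 1 → 2 * r + 5 ≤ q → ∃[ s ] (q ≡ 1 + (r + 2 + s) * 2)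
odd-decomposition {q} r odd 2r+5≤q =
  t ∸ (r + 2) , trans q≡1+2t (cong (λ u → 1 + u * 2) (sym (m+[n∸m]≡n r+2≤t)))
  where
  t = q / 2
  q≡1+2t : q ≡ 1 + t * 2
  q≡1+2t = trans (m≡m%n+[m/n]*n q 2) (cong (_+ t * 2) odd)
  2r+5≡ : 2 * r + 5 ≡ 1 + (r + 2) * 2
  2r+5≡ = solve (r ∷ [])
  r+2≤t : r + 2 ≤ t
  r+2≤t = *-cancelʳ-≤ (r + 2) t 2 (s≤s⁻¹ (subst₂ _≤_ 2r+5≡ q≡1+2t 2r+5≤q))

-- The polynomial identities behind the size count, for q = 2t + 1 and t = r + 2 + s.
module _ {q : ℕ} (r s : ℕ) where

  r[q+1]≡2r[t+1] : q ≡ 1 + (r + 2 + s) * 2 → r * (q + 1) ≡ r * (r + 2 + s + 1) * 2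
  r[q+1]≡2r[t+1] refl = solve (r ∷ s ∷ [])

  qt≡r[t+1]+size : q ≡ 1 + (r + 2 + s) * 2 →
                   q * (r + 2 + s) ≡ r * (r + 2 + s + 1) + (q * (2 + s) + r * (r + 2 + s))
  qt≡r[t+1]+size refl = solve (r ∷ s ∷ [])

  2size+r≡q*[4+2s+r] : q ≡ 1 + (r + 2 + s) * 2 →
                       2 * (q * (2 + s) + r * (r + 2 + s)) + r ≡ (4 + 2 * s + r) * q
  2size+r≡q*[4+2s+r] refl = solve (r ∷ s ∷ [])

  q≡3+r+[r+2+2s] : q ≡ 1 + (r + 2 + s) * 2 → q ≡ 3 + r + (r + 2 + 2 * s)
  q≡3+r+[r+2+2s] refl = solve (r ∷ s ∷ [])

target-size : ∀ {q} r s → q ≡ 1 + (r + 2 + s) * 2 →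
              (q * (q ∸ 1)) / 2 ∸ (r * (q + 1)) / 2 ≡ q * (2 + s) + r * (r + 2 + s)
target-size {q} r s q≡ = begin
  (q * (q ∸ 1)) / 2 ∸ (r * (q + 1)) / 2
    ≡⟨ cong₂ (λ a b → a / 2 ∸ b / 2) q[q∸1]≡qt*2 (r[q+1]≡2r[t+1] r s q≡) ⟩
  (q * t * 2) / 2 ∸ (r * (t + 1) * 2) / 2
    ≡⟨ cong₂ _∸_ (m*n/n≡m (q * t) 2) (m*n/n≡m (r * (t + 1)) 2) ⟩
  q * t ∸ r * (t + 1)
    ≡⟨ cong (_∸ r * (t + 1)) (qt≡r[t+1]+size r s q≡) ⟩
  r * (t + 1) + size ∸ r * (t + 1)
    ≡⟨ m+n∸m≡n (r * (t + 1)) size ⟩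
  size ∎
  where
  open ≡-Reasoning
  t = r + 2 + s
  size = q * (2 + s) + r * t
  q[q∸1]≡qt*2 : q * (q ∸ 1) ≡ q * t * 2
  q[q∸1]≡qt*2 = trans (cong (λ m → q * (m ∸ 1)) q≡) (sym (ℕ.*-assoc q t 2))

target≤square : ∀ q r → (q * (q ∸ 1)) / 2 ∸ (r * (q + 1)) / 2 ≤ q * q
target≤square q r =
  ≤-trans (m∸n≤m ((q * (q ∸ 1)) / 2) ((r * (q + 1)) / 2))
          (≤-trans (m/n≤m (q * (q ∸ 1)) 2) (*-monoʳ-≤ q (m∸n≤m q 1)))

m∸n≡1⇒m≡1+n : ∀ {m n} → m ∸ n ≡ 1 → m ≡ 1 + n
m∸n≡1⇒m≡1+n {m} {n} m∸n≡1 = trans (sym (m∸n+n≡m n≤m)) (cong (_+ n) m∸n≡1)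
  where
  n≤m : n ≤ m
  n≤m = <⇒≤ (m∸n≢0⇒n<m (λ m∸n≡0 → 1+n≢0 (trans (sym m∸n≡1) m∸n≡0)))

size-remainder≢1 : ∀ {q} r s → q ≡ 1 + (r + 2 + s) * 2 →
                   Remainder≢1 q (q * (2 + s) + r * (r + 2 + s))
size-remainder≢1 {q} r s q≡ j size∸jq≡1 = <⇒≱ 2+r<q (∣⇒≤ q∣2+r)
  where
  open ≡-Reasoning
  size = q * (2 + s) + r * (r + 2 + s)
  q∣2j*q+2+r : q ∣ q * (2 * j) + (2 + r)
  q∣2j*q+2+r = divides (4 + 2 * s + r) (begin
    q * (2 * j) + (2 + r) ≡⟨ solve (q ∷ j ∷ r ∷ []) ⟩
    2 * (1 + j * q) + r   ≡⟨ cong (λ m → 2 * m + r) (sym (m∸n≡1⇒m≡1+n size∸jq≡1)) ⟩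
    2 * size + r          ≡⟨ 2size+r≡q*[4+2s+r] r s q≡ ⟩
    (4 + 2 * s + r) * q   ∎)
  q∣2+r : q ∣ 2 + r
  q∣2+r = ∣m+n∣m⇒∣n q∣2j*q+2+r (m∣m*n (2 * j))
  2+r<q : 2 + r < q
  2+r<q = ≤-trans (m≤m+n (3 + r) (r + 2 + 2 * s)) (≤-reflexive (sym (q≡3+r+[r+2+2s] r s q≡)))

theorem2p10 : (q : ℕ) → IsPrimePower q → q % 2 ≡ 1 → (F : FiniteField q) →
    (r : ℕ) → 2 * r + 5 ≤ q →
    let open PG2 F in
    ∃[ S ] (All Normalized S × Unique S × WithoutTangents S ×
            length S ≡ (q * (q ∸ 1)) / 2 ∸ (r * (q + 1)) / 2)
theorem2p10 q _ odd F r 2r+5≤q with odd-decomposition r odd 2r+5≤q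
... | s , q≡ =
  let S , normalized , unique , withoutTangents , |S|≡size =
        AffineColumns.tangentFree-of-size F two-columns size≤q² (size-remainder≢1 r s q≡)
  in  S , normalized , unique , withoutTangents , trans |S|≡size (sym target≡size)
  where
  target≡size = target-size r s q≡
  two-columns : q * 2 ≤ q * (2 + s) + r * (r + 2 + s)
  two-columns = ≤-trans (*-monoʳ-≤ q (m≤m+n 2 s)) (m≤m+n _ _)
  size≤q² : q * (2 + s) + r * (r + 2 + s) ≤ q * q
  size≤q² = subst (_≤ q * q) target≡size (target≤square q r)
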